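{- Let $r\ge 1$ and $k\ge 1$ be integers, and let $T$ be an integer sequence satisfying a homogeneous meta-Fibonacci recursion $$T(n)=\sum_{p=1}^{k} T\big(S_p(n,T_{<n})\big)\qquad (n>r)$$ with $r$ given initial values $T(1),\dots,T(r)$, where each spot function $S_p(n)=S_p(n,T_{<n})$ depends only on $n$ and the values $T(j)$, $j<n$, and satisfies $1\le S_p(n)<n$ for all $n>r$. Fix $p\in\{1,\dots,k\}$ and define the generation sequence $M_p$ by $M_p(n)=1$ for $1\le n\le r$ and $M_p(n)=M_p(S_p(n))+1$ for $n>r$. If the spot sequence $(S_p(n))_{n>r}$ is slow-growing, then $M_p$ is slow-growing.
   Context: A sequence $(x_n)$ is called slow-growing (or slow) if it is monotonically nondecreasing with $x_{n+1}-x_n\in\{0,1\}$ for all $n$ in its domain. $M_p$ is called the generation sequence of $T$ based on spot $p$. -}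

module Defs where

open import Data.Nat using (ℕ; zero; suc; _<_; _≤_)
open import Data.Integer using (ℤ)
import Data.Integer as ℤ
open import Data.Fin using (Fin)
open import Data.Sum using (_⊎_)
open import Relation.Binary.PropositionalEquality using (_≡_)

sumFin : (k : ℕ) → (Fin k → ℤ) → ℤ
sumFin zero    f = ℤ.+ 0
sumFin (suc k) f = f Fin.zero ℤ.+ sumFin k (λ i → f (Fin.suc i))
  where import Data.Fin as Fin

SlowFrom : ℕ → (ℕ → ℕ) → Set
SlowFrom a x = ∀ n → a ≤ n → (x (suc n) ≡ x n) ⊎ (x (suc n) ≡ suc (x n))

MetaFib : (r k : ℕ) → (T : ℕ → ℤ) → (S : Fin k → ℕ → ℕ) → Set
MetaFib r k T S =
  (∀ p n → r < n → 1 ≤ S p n × S p n < n) ×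
  (∀ n → r < n → T n ≡ sumFin k (λ p → T (S p n)))
  where open import Data.Product using (_×_)

IsGeneration : (r : ℕ) → (Sp : ℕ → ℕ) → (M : ℕ → ℕ) → Set
IsGeneration r Sp M =
  (∀ n → 1 ≤ n → n ≤ r → M n ≡ 1) ×
  (∀ n → r < n → M n ≡ suc (M (Sp n)))
  where open import Data.Product using (_×_)

module Submission where

-- Only the bounds 1 ≤ S(n) < n matter.
--
-- We show Increment (M n) (M (n+1)), i.e. M(n+1) - M(n) ∈ {0,1}, for every
-- n ≥ 1 by strong induction on n:
--   * n < r:  both values lie in the initial block, so both equal 1;
--   * n = r:  M(r+1) = M(S(r+1)) + 1 = 2 since S(r+1) ≤ r, and M(r) = 1;
--   * n > r:  M(n+1) - M(n) = M(S(n+1)) - M(S(n)); slow growth of S gives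
--             S(n+1) = S(n) (difference 0) or S(n+1) = S(n) + 1, where the
--             induction hypothesis at S(n) < n applies.

open import Defs
open import Data.Nat using (ℕ; suc; _≤_; _<_; s≤s; z≤n)
open import Data.Nat.Properties using (<-cmp; ≤-refl; <⇒≤; ≤-pred; m≤n⇒m≤1+n)
open import Data.Nat.Induction using (<-rec)
open import Data.Integer using (ℤ)
open import Data.Fin using (Fin)
open import Data.Product using (_×_; _,_; proj₁; proj₂)
open import Data.Sum using (_⊎_; inj₁; inj₂)
open import Relation.Binary.Definitions using (tri<; tri≈; tri>)
open import Relation.Binary.PropositionalEquality using (_≡_; refl; sym; trans; cong)

Increment : ℕ → ℕ → Set
Increment u v = (v ≡ u) ⊎ (v ≡ suc u)

increment-suc : ∀ {u v} → Increment u v → Increment (suc u) (suc v)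
increment-suc (inj₁ v≡u)  = inj₁ (cong suc v≡u)
increment-suc (inj₂ v≡1+u) = inj₂ (cong suc v≡1+u)

increment-subst : ∀ {u u′ v v′} → u′ ≡ u → v′ ≡ v →
                  Increment u v → Increment u′ v′
increment-subst refl refl step = step

module Generation (r : ℕ) (S : ℕ → ℕ) (M : ℕ → ℕ)
                  (spot-bounds : ∀ n → r < n → 1 ≤ S n × S n < n)
                  (gen : IsGeneration r S M) where

  initial : ∀ n → 1 ≤ n → n ≤ r → M n ≡ 1
  initial = proj₁ gen

  recursive : ∀ n → r < n → M n ≡ suc (M (S n))
  recursive = proj₂ gen

  step-in-block : ∀ n → 1 ≤ n → n < r → Increment (M n) (M (suc n))
  step-in-block n 1≤n n<r =
    inj₁ (trans (initial (suc n) (s≤s z≤n) n<r) (sym (initial n 1≤n (<⇒≤ n<r))))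

  -- Leaving the block: S(r+1) ≤ r, so M(r+1) = M(S(r+1)) + 1 = 2 = M(r) + 1.
  step-at-boundary : 1 ≤ r → Increment (M r) (M (suc r))
  step-at-boundary 1≤r =
    let (1≤s , s<1+r) = spot-bounds (suc r) ≤-refl
    in inj₂ (trans (recursive (suc r) ≤-refl)
                   (cong suc (trans (initial (S (suc r)) 1≤s (≤-pred s<1+r))
                                    (sym (initial r 1≤r ≤-refl)))))

  step-beyond : ∀ n → r < n → Increment (M (S n)) (M (S (suc n))) →
                Increment (M n) (M (suc n))
  step-beyond n r<n spot-step =
    increment-subst (recursive n r<n) (recursive (suc n) (m≤n⇒m≤1+n r<n))
                    (increment-suc spot-step)

  -- Main lemma: if the spot sequence is slow beyond r, then M is slow
  -- from 1 on.  Strong induction, since the recursion jumps back to S n < n.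
  generation-slow : SlowFrom (suc r) S → SlowFrom 1 M
  generation-slow slow = <-rec (λ n → 1 ≤ n → Increment (M n) (M (suc n))) step
    where
    step : ∀ n → (∀ {m} → m < n → 1 ≤ m → Increment (M m) (M (suc m))) →
           1 ≤ n → Increment (M n) (M (suc n))
    step n ih 1≤n with <-cmp n r
    ... | tri< n<r _ _ = step-in-block n 1≤n n<r
    ... | tri≈ _ refl _ = step-at-boundary 1≤n
    ... | tri> _ _ r<n = step-beyond n r<n spot-step
      where
      -- slow spots either stay put, or advance from S n < n, where the
      -- induction hypothesis applies
      spot-step : Increment (M (S n)) (M (S (suc n)))
      spot-step with slow n r<n
      ... | inj₁ same = inj₁ (cong M same)
      ... | inj₂ next =
        let (1≤s , s<n) = spot-bounds n r<n
        in increment-subst refl (cong M next) (ih s<n 1≤s)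

theorem1 : (r k : ℕ) → 1 ≤ r → 1 ≤ k →
    (T : ℕ → ℤ) → (S : Fin k → ℕ → ℕ) → MetaFib r k T S →
    (p : Fin k) → (M : ℕ → ℕ) → IsGeneration r (S p) M →
    SlowFrom (suc r) (S p) → SlowFrom 1 M
theorem1 r k _ _ T S metaFib p M gen =
  Generation.generation-slow r (S p) M (proj₁ metaFib p) gen
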